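{- Let $n\ge 5$ and let $\sigma$ be a maximal simplex of $\Delta_n=\mathcal{VR}(\mathbb{I}_n;3)$ that covers all places. Then $N(v)\cap\sigma\neq\emptyset$ for every $v\in\sigma$.
   Context: $\mathbb{I}_n$ is the graph on $\{0,1\}^n$, two strings adjacent iff they differ in exactly one coordinate; distance is the number of differing coordinates. $\Delta_n=\mathcal{VR}(\mathbb{I}_n;3)$ is the simplicial complex whose simplices are the sets of vertices with pairwise distance at most $3$. For a vertex $v$, $v(i)$ is its $i$-th coordinate, $v^{i}$ is $v$ with coordinate $i$ flipped, and $N(v)=\{v^i:i\in[n]\}$. A simplex $\sigma$ covers all places if for each $i\in[n]$ there are $v,w\in\sigma$ with $v(i)=1$ and $w(i)=0$. -}

module Defs where

open import Data.Bool using (Bool; true; false; not; _≟_)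
open import Relation.Nullary using (yes; no)
open import Data.Nat using (ℕ; zero; suc; _+_; _≤_)
open import Data.Fin using (Fin)
open import Data.Vec using (Vec; []; _∷_; lookup; _[_]%=_)
open import Data.List using (List)
open import Data.List.Membership.Propositional using (_∈_)
open import Data.Product using (∃₂; _×_; ∃)
open import Relation.Binary.PropositionalEquality using (_≡_)

-- Vertices of the hypercube graph 𝕀ₙ : binary strings of length n.
Vertex : ℕ → Set
Vertex n = Vec Bool n

-- Hamming distance: number of coordinates where the strings differ
-- (this is the graph distance in 𝕀ₙ).
dist : ∀ {n} → Vertex n → Vertex n → ℕ
dist []       []       = 0
dist (a ∷ u) (b ∷ w) with a ≟ b
... | yes _ = dist u w
... | no  _ = suc (dist u w)

flip : ∀ {n} → Vertex n → Fin n → Vertex n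
flip v i = v [ i ]%= not

-- A finite set of vertices (duplicates are harmless; membership is ∈).
VSet : ℕ → Set
VSet n = List (Vertex n)

IsSimplex : ∀ {n} → VSet n → Set
IsSimplex {n} σ = (∃ λ v → v ∈ σ) × (∀ v w → v ∈ σ → w ∈ σ → dist v w ≤ 3)

IsMaximalSimplex : ∀ {n} → VSet n → Set
IsMaximalSimplex {n} σ =
  IsSimplex σ × (∀ (u : Vertex n) → (∀ v → v ∈ σ → dist v u ≤ 3) → u ∈ σ)

CoversAllPlaces : ∀ {n} → VSet n → Set
CoversAllPlaces {n} σ =
  ∀ (i : Fin n) → ∃₂ λ v w → v ∈ σ × w ∈ σ × lookup v i ≡ true × lookup w i ≡ false

MeetsNeighbourhood : ∀ {n} → Vertex n → VSet n → Set
MeetsNeighbourhood {n} v σ = ∃ λ (i : Fin n) → flip v i ∈ σ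

-- Suppose v ∈ σ has no neighbour in σ. By maximality, for every place i the
-- vertex v^i is more than 3 away from some w ∈ σ, so w is at distance exactly 3
-- from v and agrees with v at i. Since σ has diameter ≤ 3, a vertex of σ can
-- differ from v at no more than one place where such a far vertex agrees with v.
-- Take a far w₀ differing from v at a, b, c and far vertices agreeing with v at
-- a, b and c; using n ≥ 5 one finds a place j such that every place x is a common
-- agreement place, together with j, of one of these four far vertices. A vertex
-- of σ differing from v at j, which exists as σ covers all places, then differs
-- from v at j only, so it is v^j: a contradiction.

module Submission where

open import Defs
open import Data.Bool using (true; false) renaming (_≟_ to _≟ᵇ_)
open import Data.Bool.Properties using (¬-not)
open import Data.Nat using (suc; _≤_; _<_; _≤?_; z≤n; s≤s)
open import Data.Nat.Properties
  using (≤-trans; ≤-antisym; ≤-reflexive; ≤-pred; n≤1+n; 1+n≰n; ≰⇒>; module ≤-Reasoning)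
open import Data.Fin using (Fin; zero; suc; punchIn; fromℕ<; _≟_)
open import Data.Fin.Properties using (any?; suc-injective; punchIn-injective; punchInᵢ≢i)
open import Data.Vec using ([]; _∷_; lookup)
open import Data.Vec.Properties using (lookup∘updateAt; lookup∘updateAt′; ≡-dec)
open import Data.Vec.Relation.Binary.Pointwise.Extensional using (ext; Pointwise-≡⇒≡)
open import Data.List using ([]; _∷_; length; map)
open import Data.List.Properties using (length-map)
open import Data.List.Relation.Unary.All as All using (All; []; _∷_)
import Data.List.Relation.Unary.All.Properties as Allₚ
open import Data.List.Relation.Unary.AllPairs using ([]; _∷_)
import Data.List.Relation.Unary.Any as Any
open import Data.List.Relation.Unary.Unique.Propositional using (Unique)
import Data.List.Relation.Unary.Unique.Propositional.Properties as Unique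
open import Data.List.Membership.Propositional using (_∈_; _∉_; find)
open import Data.Product using (∃; _×_; _,_)
open import Data.Empty using (⊥; ⊥-elim)
open import Function using (_∘_)
open import Relation.Nullary using (¬_; Dec; yes; no; contradiction)
open import Relation.Nullary.Decidable using (¬?; _×-dec_; decidable-stable)
open import Relation.Binary.PropositionalEquality

Agree : ∀ {n} → Vertex n → Vertex n → Fin n → Set
Agree x y i = lookup x i ≡ lookup y i

Differ : ∀ {n} → Vertex n → Vertex n → Fin n → Set
Differ x y i = ¬ Agree x y i

agree? : ∀ {n} (x y : Vertex n) i → Dec (Agree x y i)
agree? x y i = lookup x i ≟ᵇ lookup y i

dist-sym : ∀ {n} (x y : Vertex n) → dist x y ≡ dist y x
dist-sym []          []          = refl
dist-sym (true ∷ x)  (true ∷ y)  = dist-sym x y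
dist-sym (false ∷ x) (false ∷ y) = dist-sym x y
dist-sym (true ∷ x)  (false ∷ y) = cong suc (dist-sym x y)
dist-sym (false ∷ x) (true ∷ y)  = cong suc (dist-sym x y)

dist-flip-agree : ∀ {n} (x y : Vertex n) i → Agree x y i → dist x (flip y i) ≡ suc (dist x y)
dist-flip-agree (true ∷ x)  (true ∷ y)  zero refl = refl
dist-flip-agree (false ∷ x) (false ∷ y) zero refl = refl
dist-flip-agree (a ∷ x) (b ∷ y) (suc i) agree with a ≟ᵇ b
... | yes _ = dist-flip-agree x y i agree
... | no  _ = cong suc (dist-flip-agree x y i agree)

dist-flip-differ : ∀ {n} (x y : Vertex n) i → Differ x y i → suc (dist x (flip y i)) ≡ dist x y
dist-flip-differ (true ∷ x)  (true ∷ y)  zero differ = contradiction refl differ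
dist-flip-differ (false ∷ x) (false ∷ y) zero differ = contradiction refl differ
dist-flip-differ (true ∷ x)  (false ∷ y) zero _      = refl
dist-flip-differ (false ∷ x) (true ∷ y)  zero _      = refl
dist-flip-differ (a ∷ x) (b ∷ y) (suc i) differ with a ≟ᵇ b
... | yes _ = dist-flip-differ x y i differ
... | no  _ = cong suc (dist-flip-differ x y i differ)

differences : ∀ {n} (x y : Vertex n) →
  ∃ λ L → Unique L × All (Differ x y) L × length L ≡ dist x y
differences []      []      = [] , [] , [] , refl
differences (a ∷ x) (b ∷ y) with differences x y | a ≟ᵇ b
... | L , L! , ds , len | yes _ =
  map suc L , Unique.map⁺ suc-injective L! , Allₚ.map⁺ ds , trans (length-map suc L) len
... | L , L! , ds , len | no a≢b =
  zero ∷ map suc L , Allₚ.map⁺ (All.universal (λ _ ()) L) ∷ Unique.map⁺ suc-injective L! ,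
  a≢b ∷ Allₚ.map⁺ ds , cong suc (trans (length-map suc L) len)

differences-≤-dist : ∀ {n} (x y : Vertex n) {L} → Unique L → All (Differ x y) L → length L ≤ dist x y
differences-≤-dist x y [] [] = z≤n
differences-≤-dist x y {i ∷ L} (i∉L ∷ L!) (dᵢ ∷ ds) = begin
  suc (length L)          ≤⟨ s≤s (differences-≤-dist x (flip y i) L! (All.zipWith still-differ (i∉L , ds))) ⟩
  suc (dist x (flip y i)) ≡⟨ dist-flip-differ x y i dᵢ ⟩
  dist x y                ∎
  where
  open ≤-Reasoning
  still-differ : ∀ {k} → i ≢ k × Differ x y k → Differ x (flip y i) k
  still-differ (i≢k , dₖ) agree = dₖ (trans agree (lookup∘updateAt′ _ i (i≢k ∘ sym) y))

four-differences : ∀ {n} (x y : Vertex n) {a b c d} →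
  a ≢ b → a ≢ c → a ≢ d → b ≢ c → b ≢ d → c ≢ d →
  Differ x y a → Differ x y b → Differ x y c → Differ x y d → 4 ≤ dist x y
four-differences x y a≢b a≢c a≢d b≢c b≢d c≢d da db dc dd = differences-≤-dist x y
  ((a≢b ∷ a≢c ∷ a≢d ∷ []) ∷ (b≢c ∷ b≢d ∷ []) ∷ (c≢d ∷ []) ∷ [] ∷ [])
  (da ∷ db ∷ dc ∷ dd ∷ [])

record ThreeDifferences {n} (x y : Vertex n) : Set where
  field
    a b c           : Fin n
    a≢b             : a ≢ b
    a≢c             : a ≢ c
    b≢c             : b ≢ c
    differ-a        : Differ x y a
    differ-b        : Differ x y b
    differ-c        : Differ x y c
    agree-elsewhere : ∀ {k} → k ≢ a → k ≢ b → k ≢ c → Agree x y k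

three-differences : ∀ {n} (x y : Vertex n) → dist x y ≡ 3 → ThreeDifferences x y
three-differences x y d≡3 with differences x y
... | L , L! , ds , len = enumerate L (trans len d≡3) L! ds
  where
  enumerate : ∀ L → length L ≡ 3 → Unique L → All (Differ x y) L → ThreeDifferences x y
  enumerate (a ∷ b ∷ c ∷ []) refl ((a≢b ∷ a≢c ∷ []) ∷ (b≢c ∷ []) ∷ _) (da ∷ db ∷ dc ∷ []) = record
    { a≢b = a≢b ; a≢c = a≢c ; b≢c = b≢c
    ; differ-a = da ; differ-b = db ; differ-c = dc
    ; agree-elsewhere = λ {k} k≢a k≢b k≢c → decidable-stable (agree? x y k) λ dk →
        1+n≰n (≤-trans (four-differences x y a≢b a≢c (k≢a ∘ sym) b≢c (k≢b ∘ sym) (k≢c ∘ sym)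
                          da db dc dk)
                       (≤-reflexive d≡3))
    }

agreement-avoiding : ∀ {n} → 5 ≤ n → (x y : Vertex n) → dist x y ≤ 3 →
  ∀ a → ∃ λ j → j ≢ a × Agree x y j
agreement-avoiding (s≤s (s≤s (s≤s (s≤s (s≤s _))))) x y d≤3 a
  with any? (λ j → ¬? (j ≟ a) ×-dec agree? x y j)
... | yes found = found
... | no none = ⊥-elim (1+n≰n (≤-trans four d≤3))
  where
  apart : ∀ {i j} → i ≢ j → punchIn a i ≢ punchIn a j
  apart i≢j = i≢j ∘ punchIn-injective a _ _
  differs : ∀ i → Differ x y (punchIn a i)
  differs i agree = none (punchIn a i , punchInᵢ≢i a i , agree)
  four : 4 ≤ dist x y
  four = four-differences x y
    {punchIn a zero} {punchIn a (suc zero)} {punchIn a (suc (suc zero))} {punchIn a (suc (suc (suc zero)))}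
    (apart λ ()) (apart λ ()) (apart λ ()) (apart λ ()) (apart λ ()) (apart λ ())
    (differs _) (differs _) (differs _) (differs _)

single-difference : ∀ {n} (x y : Vertex n) {j} → Differ x y j → (∀ {k} → k ≢ j → Agree x y k) →
  y ≡ flip x j
single-difference x y {j} dj agree = Pointwise-≡⇒≡ (ext coincide)
  where
  coincide : ∀ k → lookup y k ≡ lookup (flip x j) k
  coincide k with k ≟ j
  ... | yes refl = trans (¬-not (dj ∘ sym)) (sym (lookup∘updateAt j x))
  ... | no k≢j   = trans (sym (agree k≢j)) (sym (lookup∘updateAt′ k j k≢j x))

differs-somewhere : ∀ {n} {σ : VSet n} → CoversAllPlaces σ → (v : Vertex n) (j : Fin n) →
  ∃ λ u → u ∈ σ × Differ v u j
differs-somewhere covers v j with covers j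
... | p , q , p∈σ , q∈σ , pⱼ , qⱼ with agree? v p j
... | no differ = p , p∈σ , differ
... | yes agree = q , q∈σ , λ agree′ → contradiction (trans (sym pⱼ) (trans (sym agree) (trans agree′ qⱼ))) λ ()

module IsolatedVertex {n} {σ : VSet n}
  (simplex : ∀ x y → x ∈ σ → y ∈ σ → dist x y ≤ 3)
  (maximal : ∀ u → (∀ x → x ∈ σ → dist x u ≤ 3) → u ∈ σ)
  {v : Vertex n} (v∈σ : v ∈ σ) (isolated : ∀ i → flip v i ∉ σ) where

  not-four-apart : ∀ {x y} → x ∈ σ → y ∈ σ → ¬ (4 ≤ dist x y)
  not-four-apart x∈σ y∈σ four = 1+n≰n (≤-trans four (simplex _ _ x∈σ y∈σ))

  far-agreeing : ∀ i → ∃ λ w → w ∈ σ × dist v w ≡ 3 × Agree v w i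
  far-agreeing i
    with find (Allₚ.¬All⇒Any¬ (λ x → dist x (flip v i) ≤? 3) σ
                 (isolated i ∘ maximal (flip v i) ∘ λ within _ → All.lookup within))
  ... | w , w∈σ , too-far with agree? w v i
  ... | yes agree =
    w , w∈σ , trans (dist-sym v w) (≤-antisym (simplex w v w∈σ v∈σ) three≤) , sym agree
    where
    three≤ : 3 ≤ dist w v
    three≤ = ≤-pred (subst (3 <_) (dist-flip-agree w v i agree) (≰⇒> too-far))
  ... | no differ = ⊥-elim (too-far (≤-trans (n≤1+n _)
                      (≤-trans (≤-reflexive (dist-flip-differ w v i differ)) (simplex w v w∈σ v∈σ))))

  other-difference : ∀ {u j} → u ∈ σ → Differ v u j → ∃ λ x → x ≢ j × Differ v u x
  other-difference {u} {j} u∈σ dj with any? (λ x → ¬? (x ≟ j) ×-dec ¬? (agree? v u x))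
  ... | yes found = found
  ... | no none = ⊥-elim (isolated j (subst (_∈ σ) (single-difference v u dj agree) u∈σ))
    where
    agree : ∀ {k} → k ≢ j → Agree v u k
    agree {k} k≢j = decidable-stable (agree? v u k) λ dk → none (k , k≢j , dk)

  at-most-one-difference-outside : ∀ {w w′ x₁ x₂} → w ∈ σ → w′ ∈ σ → dist v w′ ≡ 3 → x₁ ≢ x₂ →
    Differ v w x₁ → Differ v w x₂ → Agree v w′ x₁ → Agree v w′ x₂ → ⊥
  at-most-one-difference-outside {w} {w′} {x₁} {x₂} w∈σ w′∈σ d≡3 x₁≢x₂ d₁ d₂ a₁ a₂ =
    pigeonhole (agree? v w a) (agree? v w b) (agree? v w c)
    where
    open ThreeDifferences (three-differences v w′ d≡3)
    apart : ∀ {x y} → Agree v w′ x → Differ v w′ y → x ≢ y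
    apart ax dy refl = dy ax
    both-differ : ∀ {y y′} → y ≢ y′ → Differ v w′ y → Differ v w′ y′ → Differ v w y → Differ v w y′ → ⊥
    both-differ y≢y′ e e′ dy dy′ = not-four-apart v∈σ w∈σ
      (four-differences v w x₁≢x₂ (apart a₁ e) (apart a₁ e′) (apart a₂ e) (apart a₂ e′) y≢y′
        d₁ d₂ dy dy′)
    both-agree : ∀ {y y′} → y ≢ y′ → Differ v w′ y → Differ v w′ y′ → Agree v w y → Agree v w y′ → ⊥
    both-agree y≢y′ e e′ ay ay′ = not-four-apart w∈σ w′∈σ
      (four-differences w w′ x₁≢x₂ (apart a₁ e) (apart a₁ e′) (apart a₂ e) (apart a₂ e′) y≢y′
        (λ eq → d₁ (trans a₁ (sym eq))) (λ eq → d₂ (trans a₂ (sym eq)))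
        (λ eq → e (trans ay eq)) (λ eq → e′ (trans ay′ eq)))
    -- Two of the three places where w′ differs from v are treated alike by w:
    -- both differences give four differences from v, both agreements four from w′.
    pigeonhole : Dec (Agree v w a) → Dec (Agree v w b) → Dec (Agree v w c) → ⊥
    pigeonhole (yes aa) (yes ab) _        = both-agree  a≢b differ-a differ-b aa ab
    pigeonhole (no da)  (no db)  _        = both-differ a≢b differ-a differ-b da db
    pigeonhole (yes aa) (no db)  (yes ac) = both-agree  a≢c differ-a differ-c aa ac
    pigeonhole (yes aa) (no db)  (no dc)  = both-differ b≢c differ-b differ-c db dc
    pigeonhole (no da)  (yes ab) (yes ac) = both-agree  b≢c differ-b differ-c ab ac
    pigeonhole (no da)  (yes ab) (no dc)  = both-differ a≢c differ-a differ-c da dc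

  FarAgreement : Fin n → Fin n → Set
  FarAgreement j x = ∃ λ w → w ∈ σ × dist v w ≡ 3 × Agree v w j × Agree v w x

  agreement-around : ∀ {w₀} → w₀ ∈ σ → dist v w₀ ≡ 3 → (T : ThreeDifferences v w₀) → 5 ≤ n →
    ∃ λ j → ∀ x → FarAgreement j x
  agreement-around {w₀} w₀∈σ d₀ T 5≤n
    with far-agreeing (ThreeDifferences.a T) | far-agreeing (ThreeDifferences.b T)
       | far-agreeing (ThreeDifferences.c T)
  ... | wa , wa∈σ , da , aa | wb , wb∈σ , db , ab | wc , wc∈σ , dc , ac
    with agreement-avoiding 5≤n v wa (≤-reflexive da) (ThreeDifferences.a T)
  ... | j , j≢a , aj = j , agreement
    where
    open ThreeDifferences T
    wa-differs-b : Differ v wa b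
    wa-differs-b = at-most-one-difference-outside w₀∈σ wa∈σ da a≢b differ-a differ-b aa
    wa-differs-c : Differ v wa c
    wa-differs-c = at-most-one-difference-outside w₀∈σ wa∈σ da a≢c differ-a differ-c aa
    wb-differs-a : Differ v wb a
    wb-differs-a = at-most-one-difference-outside w₀∈σ wb∈σ db (a≢b ∘ sym) differ-b differ-a ab
    wc-differs-a : Differ v wc a
    wc-differs-a = at-most-one-difference-outside w₀∈σ wc∈σ dc (a≢c ∘ sym) differ-c differ-a ac
    agrees-at-j : ∀ {w} → w ∈ σ → Differ v w a → Agree v w j
    agrees-at-j {w} w∈σ differs-a = decidable-stable (agree? v w j) λ dj →
      at-most-one-difference-outside w∈σ wa∈σ da (j≢a ∘ sym) differs-a dj aa aj
    w₀-agrees-j : Agree v w₀ j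
    w₀-agrees-j = agree-elsewhere j≢a (λ { refl → wa-differs-b aj }) (λ { refl → wa-differs-c aj })
    agreement : ∀ x → FarAgreement j x
    agreement x with x ≟ a | x ≟ b | x ≟ c
    ... | yes refl | _        | _        = wa , wa∈σ , da , aj , aa
    ... | no _     | yes refl | _        = wb , wb∈σ , db , agrees-at-j wb∈σ wb-differs-a , ab
    ... | no _     | no _     | yes refl = wc , wc∈σ , dc , agrees-at-j wc∈σ wc-differs-a , ac
    ... | no x≢a   | no x≢b   | no x≢c   = w₀ , w₀∈σ , d₀ , w₀-agrees-j , agree-elsewhere x≢a x≢b x≢c

  -- The first far vertex may be taken to agree with v at any place.
  common-agreement : 5 ≤ n → ∃ λ j → ∀ x → FarAgreement j x
  common-agreement 5≤n with far-agreeing (fromℕ< 5≤n)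
  ... | w₀ , w₀∈σ , d₀ , _ = agreement-around w₀∈σ d₀ (three-differences v w₀ d₀) 5≤n

  absurd : 5 ≤ n → CoversAllPlaces σ → ⊥
  absurd 5≤n covers =
    let j , agreement           = common-agreement 5≤n
        u , u∈σ , dj            = differs-somewhere covers v j
        x , x≢j , dx            = other-difference u∈σ dj
        w , w∈σ , d≡3 , aj , ax = agreement x
    in at-most-one-difference-outside u∈σ w∈σ d≡3 (x≢j ∘ sym) dj dx aj ax

lemma4p1 : ∀ n → 5 ≤ n → (σ : VSet n) → IsMaximalSimplex σ → CoversAllPlaces σ →
    ∀ v → v ∈ σ → MeetsNeighbourhood v σ
lemma4p1 n 5≤n σ ((_ , simplex) , maximal) covers v v∈σ
  with any? (λ i → Any.any? (≡-dec _≟ᵇ_ (flip v i)) σ)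
... | yes meets    = meets
... | no  isolated = ⊥-elim (IsolatedVertex.absurd simplex maximal v∈σ (λ i → isolated ∘ (i ,_)) 5≤n covers)
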